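{- $\mathsf{VC}\text{ - }\mathsf{dim}(\mathcal{F}_3)\leq 9$; that is, no $10$-element subset of $\mathbb{R}^2$ is shattered by $\mathcal{F}_3$.
   Context: $\mathcal{F}_3$ is the family of all unions of three lines in $\mathbb{R}^2$. A family $\mathcal{S}$ shatters $P$ if for every $Z\subseteq P$ there is $S\in\mathcal{S}$ with $S\cap P=Z$. -}

module Defs where

open import Data.Fin using (Fin)
open import Data.Bool using (Bool; true)
open import Data.Product using (Σ; ∃; _×_; _,_)
open import Data.Sum using (_⊎_)
open import Relation.Binary.PropositionalEquality using (_≡_; _≢_)
open import Relation.Nullary using (¬_)
open import Relation.Binary.Structures using (IsStrictTotalOrder)
open import Algebra.Structures using (IsCommutativeRing)
open import Function.Bundles using (_⇔_)

-- An axiomatic presentation of the real numbers: a complete ordered field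
-- (unique up to isomorphism, so any model is ℝ).
record RealNumbers : Set₁ where
  infixl 6 _+_
  infixl 7 _*_
  infix 4 _<_ _≤_
  field
    ℝ : Set
    0# 1# : ℝ
    _+_ _*_ : ℝ → ℝ → ℝ
    -_ : ℝ → ℝ
    isCommutativeRing : IsCommutativeRing _≡_ _+_ _*_ -_ 0# 1#
    0≢1 : 0# ≢ 1#
    inverse : ∀ x → x ≢ 0# → ∃ λ y → x * y ≡ 1#
    _<_ : ℝ → ℝ → Set
    isStrictTotalOrder : IsStrictTotalOrder _≡_ _<_
    +-mono-< : ∀ {x y} z → x < y → x + z < y + z
    *-pos : ∀ {x y} → 0# < x → 0# < y → 0# < x * y

  _≤_ : ℝ → ℝ → Set
  x ≤ y = x < y ⊎ x ≡ y

  field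
    complete : (S : ℝ → Set) → (∃ λ x → S x) → (∃ λ b → ∀ x → S x → x ≤ b) →
               ∃ λ s → (∀ x → S x → x ≤ s) × (∀ b → (∀ x → S x → x ≤ b) → s ≤ b)

module Geometry (R : RealNumbers) where
  open RealNumbers R

  Point : Set
  Point = ℝ × ℝ

  record Line : Set where
    constructor line
    field
      a b c : ℝ
      nondeg : ¬ (a ≡ 0# × b ≡ 0#)

  _∈L_ : Point → Line → Set
  (x , y) ∈L line a b c _ = a * x + b * y ≡ c

  ThreeLines : Set
  ThreeLines = Line × Line × Line

  _∈F_ : Point → ThreeLines → Set
  p ∈F (ℓ₁ , ℓ₂ , ℓ₃) = p ∈L ℓ₁ ⊎ p ∈L ℓ₂ ⊎ p ∈L ℓ₃

  ShatteredByF₃ : ∀ {n} → (Fin n → Point) → Set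
  ShatteredByF₃ {n} P =
    (Z : Fin n → Bool) → ∃ λ (S : ThreeLines) → ∀ i → (P i ∈F S) ⇔ (Z i ≡ true)

-- The only geometric fact used is that two lines sharing two distinct points coincide, and
-- shattering is only used for the set of all ten points and for the sets "all points but p".
--
-- Peeling: if m lines cover a set S and some line ℓ carries m + 1 points of S, then by
-- pigeonhole one covering line shares two of them with ℓ, hence contains ℓ, and the other
-- m − 1 lines cover the points of S off ℓ.  For the three lines cutting out "all but p",
-- peeling a line through p would cover p.  Hence no line carries five points (peel the
-- other four), so of the lines A, B, C covering all ten points, A carries four points and
-- six points lie off A.  No line D carries four points off A (cut out a point of A, peel D,
-- then A).  So among the six points off A, three lie on B off C and three on C; cutting out
-- one point e of the first three, we can peel A, then C, then B, which covers e.
module Submission where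

open import Defs
open import Level using (0ℓ; _⊔_)
open import Algebra.Bundles using (CommutativeRing)
open import Data.Bool using (Bool; true)
open import Data.Bool.Properties using (not-¬)
open import Data.Empty using (⊥)
open import Data.Fin using (Fin; zero; suc; punchIn; punchOut)
open import Data.Fin.Properties using (punchIn-punchOut) renaming (_≟_ to _≟ᶠ_)
open import Data.List using (List; []; _∷_; length; filter; allFin)
open import Data.List.Properties using (length-tabulate)
open import Data.List.Relation.Unary.All as All using (All; []; _∷_)
import Data.List.Relation.Unary.All.Properties as All
open import Data.List.Relation.Unary.Unique.Propositional using (Unique; []; _∷_)
import Data.List.Relation.Unary.Unique.Propositional.Properties as Unique
open import Data.List.Relation.Ternary.Interleaving.Properties using (interleave-length)
import Data.List.Relation.Ternary.Interleaving.Propositional.Properties as Interleaving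
open import Data.Nat using (ℕ; _≤_; s≤s; _≤?_)
open import Data.Nat.Properties using (+-suc; *-identityʳ; +-cancelˡ-≤; +-monoˡ-≤; ≮⇒≥; ≤-reflexive; module ≤-Reasoning)
open import Data.Product using (∃; ∃₂; _×_; _,_; proj₁; proj₂; swap)
open import Data.Sum using (_⊎_; inj₁; inj₂; [_,_]′)
open import Data.Unit using (tt)
open import Function using (_∘_; id; flip)
open import Function.Bundles using (_⇔_; Equivalence; mk⇔)
open import Function.Construct.Composition using (_⇔-∘_)
open import Function.Construct.Symmetry using (⇔-sym)
open import Function.Definitions using (Injective)
open import Relation.Binary.Definitions using (DecidableEquality)
open import Relation.Binary.PropositionalEquality
  using (_≡_; _≢_; refl; sym; trans; cong; cong₂; subst; module ≡-Reasoning)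
open import Relation.Binary.Structures using (IsStrictTotalOrder)
open import Relation.Nullary using (¬_; Dec; yes; no; ¬?; contradiction)
open import Relation.Nullary.Decidable using (does; dec-true; dec-false)
open import Relation.Unary using (Pred; Decidable; U; _∈_; _∉_; _⊆_; _∩_; ∁)

module _ {a} {A : Set a} where
  open import Data.Nat using (_+_; _*_)

  record AtLeast {p} (k : ℕ) (Q : Pred A p) : Set (a ⊔ p) where
    constructor atLeast
    field
      elems  : List A
      unique : Unique elems
      all    : All Q elems
      enough : k ≤ length elems

  AtLeast-mono : ∀ {p q k} {Q : Pred A p} {Q′ : Pred A q} → Q ⊆ Q′ → AtLeast k Q → AtLeast k Q′
  AtLeast-mono Q⊆Q′ (atLeast xs u qs k≤) = atLeast xs u (All.map Q⊆Q′ qs) k≤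

  AtLeast-uncons : ∀ {p k} {Q : Pred A p} → AtLeast (ℕ.suc k) Q → ∃ λ x → Q x × AtLeast k (Q ∩ (x ≢_))
  AtLeast-uncons (atLeast (x ∷ xs) (x∉xs ∷ u) (qx ∷ qs) (s≤s k≤)) =
    x , qx , atLeast xs u (All.zip (qs , x∉xs)) k≤

  AtLeast-cons : ∀ {p k x} {Q : Pred A p} → Q x → AtLeast k (Q ∩ (x ≢_)) → AtLeast (ℕ.suc k) Q
  AtLeast-cons {x = x} qx (atLeast xs u qs k≤) =
    atLeast (x ∷ xs) (All.map proj₂ qs ∷ u) (qx ∷ All.map proj₁ qs) (s≤s k≤)

  AtLeast-two : ∀ {p} {Q : Pred A p} → AtLeast 2 Q → ∃₂ λ x y → x ≢ y × Q x × Q y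
  AtLeast-two two =
    let x , qx , one = AtLeast-uncons two
        y , (qy , x≢y) , _ = AtLeast-uncons one
    in x , y , x≢y , qx , qy

  AtLeast-split : ∀ {p r k n} {Q : Pred A p} {R : Pred A r} → Decidable R → AtLeast (k + n) Q →
                  AtLeast (ℕ.suc k) (Q ∩ R) ⊎ AtLeast n (Q ∩ ∁ R)
  AtLeast-split {k = k} {n} R? (atLeast xs u qs k+n≤) with ℕ.suc k ≤? length (filter R? xs)
  ... | yes k<ys = inj₁ (atLeast _ (Unique.filter⁺ R? u) (All.zip (All.filter⁺ R? qs , All.all-filter R? xs)) k<ys)
  ... | no k≮ys = inj₂ (atLeast _ (Unique.filter⁺ (¬? ∘ R?) u)
                     (All.zip (All.filter⁺ (¬? ∘ R?) qs , All.all-filter (¬? ∘ R?) xs)) n≤zs)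
    where
    n≤zs : n ≤ length (filter (¬? ∘ R?) xs)
    n≤zs = +-cancelˡ-≤ k _ _ (begin
      k + n                                                  ≤⟨ k+n≤ ⟩
      length xs                                              ≡⟨ interleave-length (Interleaving.filter⁺ R? xs) ⟩
      length (filter R? xs) + length (filter (¬? ∘ R?) xs)   ≤⟨ +-monoˡ-≤ _ (≮⇒≥ k≮ys) ⟩
      k + length (filter (¬? ∘ R?) xs)                       ∎)
      where open ≤-Reasoning

  AtLeast-∁ : ∀ {p r k n} {Q : Pred A p} {R : Pred A r} → Decidable R → ¬ AtLeast (ℕ.suc k) (Q ∩ R) →
              AtLeast (k + n) Q → AtLeast n (Q ∩ ∁ R)
  AtLeast-∁ R? few pts = [ flip contradiction few , id ]′ (AtLeast-split R? pts)

  pigeonhole : ∀ {p r} m k {Q : Pred A p} {R : Fin m → Pred A r} → (∀ t → Decidable (R t)) →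
               Q ⊆ (λ x → ∃ λ t → R t x) → AtLeast (ℕ.suc (m * k)) Q → ∃ λ t → AtLeast (ℕ.suc k) (Q ∩ R t)
  pigeonhole ℕ.zero k R? cover (atLeast (_ ∷ _) _ (qx ∷ _) _) with () ← cover qx
  pigeonhole (ℕ.suc m) k {Q} {R} R? cover pts
    with AtLeast-split (R? zero) (subst (λ n → AtLeast n Q) (sym (+-suc k (m * k))) pts)
  ... | inj₁ many = zero , many
  ... | inj₂ rest =
    let t , many = pigeonhole m k (R? ∘ suc) cover-rest rest
    in suc t , AtLeast-mono (λ ((qx , _) , rx) → qx , rx) many
    where
    cover-rest : Q ∩ ∁ (R zero) ⊆ (λ x → ∃ λ t → R (suc t) x)
    cover-rest (qx , x∉R₀) with cover qx
    ... | zero , x∈R₀ = contradiction x∈R₀ x∉R₀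
    ... | suc t , x∈R = t , x∈R

AtLeast-allFin : ∀ n → AtLeast n (U {A = Fin n})
AtLeast-allFin n =
  atLeast (allFin n) (Unique.allFin⁺ n) (All.universal-U (allFin n)) (≤-reflexive (sym (length-tabulate id)))

module LineCovers {Pt L : Set} (points : L → Pred Pt 0ℓ) where

  Covers : ∀ {m p} → (Fin m → L) → Pred Pt p → Set p
  Covers ls S = S ⊆ (λ x → ∃ λ t → x ∈ points (ls t))

  Avoids : ∀ {m} → (Fin m → L) → Pt → Set
  Avoids ls p = ∀ t → p ∉ points (ls t)

  Covers-punchIn : ∀ {m p} {ls : Fin (ℕ.suc m) → L} {S : Pred Pt p} → Covers ls S →
                   ∀ t → Covers (ls ∘ punchIn t) (S ∩ ∁ (points (ls t)))
  Covers-punchIn {ls = ls} cov t (x∈S , x∉ℓ) with cov x∈S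
  ... | t′ , x∈ℓ′ = punchOut t≢t′ , subst (λ s → _ ∈ points (ls s)) (sym (punchIn-punchOut t≢t′)) x∈ℓ′
    where
    t≢t′ : t ≢ t′
    t≢t′ refl = x∉ℓ x∈ℓ′

  Covers-single : ∀ {p} {ls : Fin 1 → L} {S : Pred Pt p} → Covers ls S → S ⊆ points (ls zero)
  Covers-single cov x∈S with zero , x∈ℓ ← cov x∈S = x∈ℓ

  ∉∈⇒≢ : ∀ {p} {P : Pred Pt p} {x y} → x ∉ P → y ∈ P → x ≢ y
  ∉∈⇒≢ x∉P y∈P refl = x∉P y∈P

  ∈∉⇒≢ : ∀ {p} {P : Pred Pt p} {x y} → x ∈ P → y ∉ P → x ≢ y
  ∈∉⇒≢ x∈P y∉P refl = y∉P x∈P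

  module _ (points? : ∀ ℓ → Decidable (points ℓ))
           (two-points⇒⊆ : ∀ ℓ ℓ′ {x y} → x ≢ y → x ∈ points ℓ → y ∈ points ℓ →
                           x ∈ points ℓ′ → y ∈ points ℓ′ → points ℓ ⊆ points ℓ′)
           where

    peel : ∀ {m p} {S : Pred Pt p} {ls : Fin (ℕ.suc m) → L} ℓ → Covers ls S →
           AtLeast (ℕ.suc (ℕ.suc m)) (S ∩ points ℓ) →
           ∃ λ t → points ℓ ⊆ points (ls t) × Covers (ls ∘ punchIn t) (S ∩ ∁ (points ℓ))
    peel {m} {S = S} {ls} ℓ cov pts =
      let t , two = pigeonhole (ℕ.suc m) 1 (points? ∘ ls) (cov ∘ proj₁)
                      (subst (λ n → AtLeast (ℕ.suc n) (S ∩ points ℓ)) (sym (*-identityʳ (ℕ.suc m))) pts)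
          x , y , x≢y , ((_ , x∈ℓ) , x∈ℓt) , ((_ , y∈ℓ) , y∈ℓt) = AtLeast-two two
      in t , two-points⇒⊆ ℓ (ls t) x≢y x∈ℓ y∈ℓ x∈ℓt y∈ℓt ,
         λ (z∈S , z∉ℓ) → Covers-punchIn cov t (z∈S , z∉ℓ ∘ two-points⇒⊆ (ls t) ℓ x≢y x∈ℓt y∈ℓt x∈ℓ y∈ℓ)

    module _ (cut : ∀ p → ∃ λ (ls : Fin 3 → L) → Covers ls (p ≢_) × Avoids ls p) where

      no-five : ∀ ℓ → ¬ AtLeast 5 (points ℓ)
      no-five ℓ five =
        let p , p∈ℓ , four = AtLeast-uncons five
            ls , cov , avoid = cut p
            t , ℓ⊆ , _ = peel ℓ cov (AtLeast-mono swap four)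
        in avoid t (ℓ⊆ p∈ℓ)

      four-off⇒disjoint : ∀ {A D x} → AtLeast 4 (points D ∩ ∁ (points A)) → x ∈ points A → x ∉ points D
      four-off⇒disjoint four-on-D x∈A x∈D =
        no-five _ (AtLeast-cons x∈D (AtLeast-mono (λ (y∈D , y∉A) → y∈D , ∈∉⇒≢ x∈A y∉A) four-on-D))

      at-most-three-off : ∀ {A} → AtLeast 4 (points A) → ∀ D → ¬ AtLeast 4 (points D ∩ ∁ (points A))
      at-most-three-off four-on-A D four-on-D =
        let a , a∈A , three-on-A = AtLeast-uncons four-on-A
            ls , cov , avoid = cut a
            t , _ , cov′ = peel D cov (AtLeast-mono (λ (x∈D , x∉A) → ∈∉⇒≢ a∈A x∉A , x∈D) four-on-D)
            t′ , A⊆ , _ = peel _ cov′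
              (AtLeast-mono (λ (x∈A , a≢x) → (a≢x , four-off⇒disjoint four-on-D x∈A) , x∈A) three-on-A)
        in avoid (punchIn t t′) (A⊆ a∈A)

      six-off⇒three-off : ∀ {A} → AtLeast 4 (points A) → AtLeast 6 (∁ (points A)) →
                          ∀ D → AtLeast 3 (∁ (points A) ∩ ∁ (points D))
      six-off⇒three-off four-on-A six-off-A D =
        AtLeast-∁ (points? D) (at-most-three-off four-on-A D ∘ AtLeast-mono swap) six-off-A

      no-4-3-3-configuration : ∀ {A B C} → AtLeast 4 (points A) →
        AtLeast 3 ((∁ (points A) ∩ ∁ (points C)) ∩ points B) → AtLeast 3 (∁ (points A) ∩ points C) → ⊥
      no-4-3-3-configuration {A} {B} {C} four-on-A three-on-B three-on-C =
        let e , ((e∉A , e∉C) , e∈B) , two-on-B = AtLeast-uncons three-on-B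
            ls , cov , avoid = cut e
            t₁ , _ , cov₁ = peel A cov (AtLeast-mono (λ x∈A → ∉∈⇒≢ e∉A x∈A , x∈A) four-on-A)
            t₂ , _ , cov₂ = peel C cov₁
              (AtLeast-mono (λ (x∉A , x∈C) → (∉∈⇒≢ e∉C x∈C , x∉A) , x∈C) three-on-C)
            t₃ , B⊆ , _ = peel B cov₂
              (AtLeast-mono (λ (((x∉A , x∉C) , x∈B) , e≢x) → ((e≢x , x∉A) , x∉C) , x∈B) two-on-B)
        in avoid (punchIn t₁ (punchIn t₂ t₃)) (B⊆ e∈B)

      not-shattered : AtLeast 10 U → ¬ ∃ (λ (ls : Fin 3 → L) → Covers ls U)
      not-shattered ten (ls , cov) =
        let t , four = pigeonhole 3 3 (points? ∘ ls) cov ten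
            A = ls t
            B = ls (punchIn t zero)
            C = ls (punchIn t (suc zero))
            four-on-A = AtLeast-mono proj₂ four
            six-off-A = AtLeast-mono proj₂ (AtLeast-∁ (points? A) (no-five A ∘ AtLeast-mono proj₂) ten)
            cov-off-A : Covers (ls ∘ punchIn t) (∁ (points A))
            cov-off-A x∉A = Covers-punchIn cov t (tt , x∉A)
            on-B : ∁ (points A) ∩ ∁ (points C) ⊆ points B
            on-B = Covers-single (Covers-punchIn cov-off-A (suc zero))
            on-C : ∁ (points A) ∩ ∁ (points B) ⊆ points C
            on-C = Covers-single (Covers-punchIn cov-off-A zero)
        in no-4-3-3-configuration four-on-A
             (AtLeast-mono (λ x∉AC → x∉AC , on-B x∉AC) (six-off⇒three-off four-on-A six-off-A C))
             (AtLeast-mono (λ x∉AB → proj₁ x∉AB , on-C x∉AB) (six-off⇒three-off four-on-A six-off-A B))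

module LineGeometry (R : RealNumbers) where
  open RealNumbers R
  open Geometry R

  commutativeRing : CommutativeRing 0ℓ 0ℓ
  commutativeRing = record { isCommutativeRing = isCommutativeRing }

  open CommutativeRing commutativeRing using (+-group; commutativeSemiring; *-identityˡ; -‿inverseˡ)
  open import Algebra.Properties.Group +-group using (∙-cancelˡ; ∙-cancelʳ; x∙y⁻¹≈ε⇒x≈y)
  open import Algebra.Solver.Ring.NaturalCoefficients.Default commutativeSemiring
  open ≡-Reasoning

  infix 4 _≟_
  _≟_ : DecidableEquality ℝ
  _≟_ = IsStrictTotalOrder._≟_ isStrictTotalOrder

  _∈L?_ : ∀ p ℓ → Dec (p ∈L ℓ)
  (x , y) ∈L? line a b c _ = a * x + b * y ≟ c

  *-cancelˡ-≢0 : ∀ {a u v} → a ≢ 0# → a * u ≡ a * v → u ≡ v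
  *-cancelˡ-≢0 {a} {u} {v} a≢0 au≡av with a⁻¹ , aa⁻¹≡1 ← inverse a a≢0 = begin
    u              ≡⟨ sym (*-identityˡ u) ⟩
    1# * u         ≡⟨ cong (_* u) (sym aa⁻¹≡1) ⟩
    a * a⁻¹ * u    ≡⟨ solve 3 (λ a a⁻¹ u → a :* a⁻¹ :* u := a⁻¹ :* (a :* u)) refl a a⁻¹ u ⟩
    a⁻¹ * (a * u)  ≡⟨ cong (a⁻¹ *_) au≡av ⟩
    a⁻¹ * (a * v)  ≡⟨ solve 3 (λ a a⁻¹ v → a⁻¹ :* (a :* v) := a :* a⁻¹ :* v) refl a a⁻¹ v ⟩
    a * a⁻¹ * v    ≡⟨ cong (_* v) aa⁻¹≡1 ⟩
    1# * v         ≡⟨ *-identityˡ v ⟩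
    v              ∎

  *-cancelˡ-nondeg : ∀ {a b u v} → ¬ (a ≡ 0# × b ≡ 0#) → a * u ≡ a * v → b * u ≡ b * v → u ≡ v
  *-cancelˡ-nondeg {a} nondeg au≡av bu≡bv with a ≟ 0#
  ... | no a≢0 = *-cancelˡ-≢0 a≢0 au≡av
  ... | yes a≡0 = *-cancelˡ-≢0 (λ b≡0 → nondeg (a≡0 , b≡0)) bu≡bv

  -- (u − v) (F − G) = 0, written without subtraction so that the semiring solver applies.
  cross-cancel : ∀ {u v F G} → u ≢ v → G * u + F * v ≡ F * u + G * v → F ≡ G
  cross-cancel {u} {v} {F} {G} u≢v cross = *-cancelˡ-≢0 u-v≢0 (∙-cancelʳ (G * u + F * v) _ _ (begin
    (u + - v) * F + (G * u + F * v)  ≡⟨ solve 5 (λ u n v F G → (u :+ n) :* F :+ (G :* u :+ F :* v)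
                                          := G :* u :+ F :* u :+ (n :+ v) :* F) refl u (- v) v F G ⟩
    G * u + F * u + (- v + v) * F    ≡⟨ cong (λ z → G * u + F * u + z * F) (-‿inverseˡ v) ⟩
    G * u + F * u + 0# * F           ≡⟨ solve 3 (λ u F G → G :* u :+ F :* u :+ con 0 :* F
                                          := G :* u :+ F :* u :+ con 0 :* G) refl u F G ⟩
    G * u + F * u + 0# * G           ≡⟨ cong (λ z → G * u + F * u + z * G) (sym (-‿inverseˡ v)) ⟩
    G * u + F * u + (- v + v) * G    ≡⟨ solve 5 (λ u n v F G → G :* u :+ F :* u :+ (n :+ v) :* G
                                          := (u :+ n) :* G :+ (F :* u :+ G :* v)) refl u (- v) v F G ⟩
    (u + - v) * G + (F * u + G * v)  ≡⟨ cong ((u + - v) * G +_) (sym cross) ⟩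
    (u + - v) * G + (G * u + F * v)  ∎))
    where
    u-v≢0 : u + - v ≢ 0#
    u-v≢0 u-v≡0 = u≢v (x∙y⁻¹≈ε⇒x≈y u v u-v≡0)

  +-cancel-middle : ∀ {w s s′ t} → w + (s + t) ≡ w + (s′ + t) → s ≡ s′
  +-cancel-middle {w} {s} {s′} {t} eq = ∙-cancelʳ t s s′ (∙-cancelˡ w _ _ eq)

  form : Line → Point → ℝ
  form (line a b _ _) (x , y) = a * x + b * y

  -- The orientation determinant of three points is orient⁺ − orient⁻.
  orient⁺ orient⁻ : Point → Point → Point → ℝ
  orient⁺ (x₁ , y₁) (x₂ , y₂) (x₃ , y₃) = x₁ * y₂ + x₂ * y₃ + x₃ * y₁
  orient⁻ (x₁ , y₁) (x₂ , y₂) (x₃ , y₃) = x₂ * y₁ + x₃ * y₂ + x₁ * y₃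

  Collinear : Point → Point → Point → Set
  Collinear p q r = orient⁺ p q r ≡ orient⁻ p q r

  -- a (resp. b) times the orientation determinant is a combination, with coefficients summing
  -- to zero, of the values cp, cq, cr of the linear form of ℓ = (a, b, c) at p, q, r.  So the
  -- determinant vanishes when all three values are c; and if it vanishes and two values are c,
  -- the third one is c too.
  orient-identityᵃ : ∀ {ℓ p q r cp cq cr} → form ℓ p ≡ cp → form ℓ q ≡ cq → form ℓ r ≡ cr →
    Line.a ℓ * orient⁺ p q r + (cq * proj₂ p + cr * proj₂ q + cp * proj₂ r) ≡
    Line.a ℓ * orient⁻ p q r + (cr * proj₂ p + cp * proj₂ q + cq * proj₂ r)
  orient-identityᵃ {line a b _ _} {x₁ , y₁} {x₂ , y₂} {x₃ , y₃} refl refl refl =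
    solve 8 (λ a b x₁ y₁ x₂ y₂ x₃ y₃ →
        a :* (x₁ :* y₂ :+ x₂ :* y₃ :+ x₃ :* y₁)
          :+ ((a :* x₂ :+ b :* y₂) :* y₁ :+ (a :* x₃ :+ b :* y₃) :* y₂ :+ (a :* x₁ :+ b :* y₁) :* y₃)
      := a :* (x₂ :* y₁ :+ x₃ :* y₂ :+ x₁ :* y₃)
          :+ ((a :* x₃ :+ b :* y₃) :* y₁ :+ (a :* x₁ :+ b :* y₁) :* y₂ :+ (a :* x₂ :+ b :* y₂) :* y₃))
      refl a b x₁ y₁ x₂ y₂ x₃ y₃

  orient-identityᵇ : ∀ {ℓ p q r cp cq cr} → form ℓ p ≡ cp → form ℓ q ≡ cq → form ℓ r ≡ cr →
    Line.b ℓ * orient⁺ p q r + (cr * proj₁ p + cp * proj₁ q + cq * proj₁ r) ≡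
    Line.b ℓ * orient⁻ p q r + (cq * proj₁ p + cr * proj₁ q + cp * proj₁ r)
  orient-identityᵇ {line a b _ _} {x₁ , y₁} {x₂ , y₂} {x₃ , y₃} refl refl refl =
    solve 8 (λ a b x₁ y₁ x₂ y₂ x₃ y₃ →
        b :* (x₁ :* y₂ :+ x₂ :* y₃ :+ x₃ :* y₁)
          :+ ((a :* x₃ :+ b :* y₃) :* x₁ :+ (a :* x₁ :+ b :* y₁) :* x₂ :+ (a :* x₂ :+ b :* y₂) :* x₃)
      := b :* (x₂ :* y₁ :+ x₃ :* y₂ :+ x₁ :* y₃)
          :+ ((a :* x₂ :+ b :* y₂) :* x₁ :+ (a :* x₃ :+ b :* y₃) :* x₂ :+ (a :* x₁ :+ b :* y₁) :* x₃))
      refl a b x₁ y₁ x₂ y₂ x₃ y₃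

  ∈L⇒Collinear : ∀ {ℓ p q r} → p ∈L ℓ → q ∈L ℓ → r ∈L ℓ → Collinear p q r
  ∈L⇒Collinear {ℓ@(line _ _ _ nondeg)} {p@(_ , _)} {q@(_ , _)} {r@(_ , _)} p∈ℓ q∈ℓ r∈ℓ =
    *-cancelˡ-nondeg nondeg (∙-cancelʳ _ _ _ (orient-identityᵃ {ℓ} {p} {q} {r} p∈ℓ q∈ℓ r∈ℓ))
                            (∙-cancelʳ _ _ _ (orient-identityᵇ {ℓ} {p} {q} {r} p∈ℓ q∈ℓ r∈ℓ))

  Collinear⇒∈L : ∀ {ℓ p q r} → p ≢ q → Collinear p q r → p ∈L ℓ → q ∈L ℓ → r ∈L ℓ
  Collinear⇒∈L {ℓ@(line a b c _)} {p@(x₁ , y₁)} {q@(x₂ , y₂)} {r@(x₃ , y₃)} p≢q col p∈ℓ q∈ℓ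
    with x₁ ≟ x₂
  ... | no x₁≢x₂ = sym (cross-cancel x₁≢x₂ (+-cancel-middle
        (trans (cong₂ _+_ (cong (b *_) (sym col)) refl) (orient-identityᵇ {ℓ} {p} {q} {r} p∈ℓ q∈ℓ refl))))
  ... | yes x₁≡x₂ = cross-cancel (λ y₁≡y₂ → p≢q (cong₂ _,_ x₁≡x₂ y₁≡y₂)) (+-cancel-middle
        (trans (cong₂ _+_ (cong (a *_) (sym col)) refl) (orient-identityᵃ {ℓ} {p} {q} {r} p∈ℓ q∈ℓ refl)))

  through-two-points : ∀ {ℓ ℓ′ p q r} → p ≢ q → p ∈L ℓ → q ∈L ℓ → p ∈L ℓ′ → q ∈L ℓ′ → r ∈L ℓ → r ∈L ℓ′
  through-two-points {ℓ} {ℓ′} p≢q p∈ℓ q∈ℓ p∈ℓ′ q∈ℓ′ r∈ℓ =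
    Collinear⇒∈L {ℓ′} p≢q (∈L⇒Collinear {ℓ} p∈ℓ q∈ℓ r∈ℓ) p∈ℓ′ q∈ℓ′

module Shattering (R : RealNumbers) (P : Fin 10 → Geometry.Point R) where
  open Geometry R
  open LineGeometry R using (_∈L?_; through-two-points)

  onLine : Line → Pred (Fin 10) 0ℓ
  onLine ℓ i = P i ∈L ℓ

  onLine? : ∀ ℓ → Decidable (onLine ℓ)
  onLine? ℓ i = P i ∈L? ℓ

  open LineCovers onLine public using (Covers; Avoids)

  onLine-two-points : Injective _≡_ _≡_ P → ∀ ℓ ℓ′ {i j} → i ≢ j → i ∈ onLine ℓ → j ∈ onLine ℓ →
                      i ∈ onLine ℓ′ → j ∈ onLine ℓ′ → onLine ℓ ⊆ onLine ℓ′
  onLine-two-points P-injective ℓ ℓ′ {i} {j} i≢j i∈ℓ j∈ℓ i∈ℓ′ j∈ℓ′ {k} =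
    through-two-points {ℓ} {ℓ′} {P i} {P j} {P k} (i≢j ∘ P-injective) i∈ℓ j∈ℓ i∈ℓ′ j∈ℓ′

  lines : ThreeLines → Fin 3 → Line
  lines (ℓ₁ , _ , _) zero = ℓ₁
  lines (_ , ℓ₂ , _) (suc zero) = ℓ₂
  lines (_ , _ , ℓ₃) (suc (suc zero)) = ℓ₃

  ∈F⇔∈lines : ∀ {p} S → p ∈F S ⇔ ∃ λ t → p ∈L lines S t
  ∈F⇔∈lines (_ , _ , _) = mk⇔
    (λ { (inj₁ p∈ℓ)        → zero , p∈ℓ
       ; (inj₂ (inj₁ p∈ℓ)) → suc zero , p∈ℓ
       ; (inj₂ (inj₂ p∈ℓ)) → suc (suc zero) , p∈ℓ })
    (λ { (zero , p∈ℓ)           → inj₁ p∈ℓ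
       ; (suc zero , p∈ℓ)       → inj₂ (inj₁ p∈ℓ)
       ; (suc (suc zero) , p∈ℓ) → inj₂ (inj₂ p∈ℓ) })

  module _ (shattered : ShatteredByF₃ P) where

    cut-out : (Z : Fin 10 → Bool) → ∃ λ (ls : Fin 3 → Line) → ∀ i → (∃ λ t → i ∈ onLine (ls t)) ⇔ (Z i ≡ true)
    cut-out Z =
      let S , cuts = shattered Z
      in lines S , λ i → cuts i ⇔-∘ ⇔-sym (∈F⇔∈lines S)

    cover-all : ∃ λ (ls : Fin 3 → Line) → Covers ls U
    cover-all = let ls , cuts = cut-out (λ _ → true) in ls , λ {i} _ → Equivalence.from (cuts i) refl

    cover-all-but : ∀ p → ∃ λ (ls : Fin 3 → Line) → Covers ls (p ≢_) × Avoids ls p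
    cover-all-but p =
      let ls , cuts = cut-out (λ i → does (¬? (p ≟ᶠ i)))
      in ls , (λ {i} p≢i → Equivalence.from (cuts i) (dec-true (¬? (p ≟ᶠ i)) p≢i))
            , (λ t p∈ℓ → not-¬ (dec-false (¬? (p ≟ᶠ p)) (λ p≢p → p≢p refl))
                                (Equivalence.to (cuts p) (t , p∈ℓ)))

proposition6p1 : (R : RealNumbers) → (P : Fin 10 → Geometry.Point R) →
                   Injective _≡_ _≡_ P → ¬ Geometry.ShatteredByF₃ R P
proposition6p1 R P P-injective shattered =
  not-shattered onLine? (onLine-two-points P-injective) (cover-all-but shattered)
    (AtLeast-allFin 10) (cover-all shattered)
  where
  open Shattering R P
  open LineCovers onLine using (not-shattered)
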